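{- For every positive integer $m$, we have $P^2=J^2=(PJ)^3=I$ in $\mathbb{F}_2^{m\times m}$.
   Context: $\mathbb{F}_2^{m\times m}$ is the set of $m\times m$ matrices over the two-element field $\mathbb{F}_2$; $I$ is the $m\times m$ identity matrix, $J=J_m$ is the $m\times m$ anti-diagonal matrix with all anti-diagonal entries $1$ (and all other entries $0$), and $P=P_m=\left(\binom{j-1}{i-1} \bmod 2\right)_{i,j=1}^m$ is the upper-triangular Pascal matrix reduced mod $2$. -}

module Defs where

open import Data.Bool using (Bool; true; false; _xor_; _∧_; if_then_else_)
open import Data.Nat using (ℕ; zero; suc; _%_; _≡ᵇ_; _+_)
open import Data.Nat.Combinatorics using (_C_)
open import Data.Fin using (Fin; toℕ; zero; suc; opposite)
open import Data.Fin.Properties using (_≟_)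
open import Relation.Nullary.Decidable using (⌊_⌋)

-- The field F₂ is modelled by Bool: addition = xor, multiplication = ∧.
-- An m×m matrix over F₂ is a function Fin m → Fin m → Bool (row, column),
-- with 0-based indices (index i here corresponds to i+1 in the paper).
Mat : ℕ → Set
Mat m = Fin m → Fin m → Bool

Σ₂ : ∀ {n} → (Fin n → Bool) → Bool
Σ₂ {zero}  f = false
Σ₂ {suc n} f = f zero xor Σ₂ (λ i → f (suc i))

infixl 7 _⊗_
_⊗_ : ∀ {m} → Mat m → Mat m → Mat m
(A ⊗ B) i j = Σ₂ (λ k → A i k ∧ B k j)

I : ∀ m → Mat m
I m i j = ⌊ i ≟ j ⌋

-- anti-diagonal all-ones matrix: entry (i,j) is 1 iff i + j = m + 1 (1-based),
-- i.e. j = opposite i (0-based: j = m - 1 - i)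
J : ∀ m → Mat m
J m i j = ⌊ j ≟ opposite i ⌋

-- upper-triangular Pascal matrix mod 2: entry (i,j) = binom(j-1, i-1) mod 2
-- (1-based), i.e. binom(j, i) mod 2 with 0-based indices.
P : ∀ m → Mat m
P m i j = ((toℕ j C toℕ i) % 2) ≡ᵇ 1

infix 4 _≋_
_≋_ : ∀ {m} → Mat m → Mat m → Set
A ≋ B = ∀ i j → A i j ≡ B i j
  where open import Relation.Binary.PropositionalEquality using (_≡_)

{-# OPTIONS --safe #-}
-- Everything reduces to the binomial transform over F₂, T h n = Σ_{k ≤ n} h k · C(n, k),
-- which obeys Pascal's rule T h (n + 1) = T h n + T (h ∘ suc) n.  Induction on n with
-- this rule shows that T sends the sequence k ↦ C(k, i) to the indicator of i, which is
-- P² = I, and the reversed sequence k ↦ C(N − k, i) to n ↦ C(N − n, N − i), which is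
-- PJP = JPJ (mod 2 the signs of the alternating identity disappear).  Since J only
-- reverses rows or columns, J² = I, (PJ)² = (PJP)J = JP, and (PJ)³ = JPPJ = JJ = I.
module Submission where

open import Defs
open import Data.Nat using (ℕ; _≤_)
open import Data.Product using (_×_)

open import Algebra.Bundles using (CommutativeRing)
open import Data.Bool using (Bool; true; false; not; _xor_; _∧_)
open import Data.Bool.Properties
  using ( xor-∧-commutativeRing; xor-comm; xor-assoc; xor-identityʳ; xor-same; not-involutive
        ; ∧-comm; ∧-identityʳ; ∧-zeroʳ; ∧-distribˡ-xor; ∧-distribʳ-xor)
open import Data.Fin using (Fin; zero; suc; toℕ; opposite)
open import Data.Fin.Properties
  using (_≟_; suc-injective; toℕ-injective; toℕ<n; toℕ≤pred[n]; opposite-prop; opposite-involutive)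
open import Data.Nat as ℕ using (zero; suc; _∸_; _<_; _%_; _≡ᵇ_; z≤n; s≤s)
open import Data.Nat.Properties using (m≤n⇒m≤1+n; n<1+n; m≤n⇒m<n∨m≡n; n∸n≡0; m∸n≤m; +-∸-assoc)
open import Data.Nat.Combinatorics using (_C_; nCk≡nC[n∸k]; nCk+nC[k+1]≡[n+1]C[k+1])
open import Data.Product using (_,_)
open import Data.Sum using (inj₁; inj₂)
open import Function using (_∘_; _⇔_; mk⇔)
open import Relation.Binary.PropositionalEquality
  using (_≡_; refl; sym; trans; cong; cong₂; module ≡-Reasoning)
open import Relation.Nullary using (Dec)
open import Relation.Nullary.Decidable using (⌊_⌋; isYes≗does; does-⇔; ⌊⌋-map′)

open CommutativeRing xor-∧-commutativeRing using (+-commutativeMonoid)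
open import Algebra.Properties.CommutativeMonoid.Sum +-commutativeMonoid
  using (sum; sum-cong-≗; sum-replicate-zero; ∑-distrib-+)

open ≡-Reasoning

xor-cancelˡ : ∀ x y → x xor (x xor y) ≡ y
xor-cancelˡ false y = refl
xor-cancelˡ true  y = not-involutive y

parity : ℕ → Bool
parity n = n % 2 ≡ᵇ 1

parity-suc : ∀ n → parity (suc n) ≡ not (parity n)
parity-suc zero          = refl
parity-suc (suc zero)    = refl
parity-suc (suc (suc n)) = parity-suc n

parity-+ : ∀ m n → parity (m ℕ.+ n) ≡ parity m xor parity n
parity-+ zero          n = refl
parity-+ (suc zero)    n = parity-suc n
parity-+ (suc (suc m)) n = parity-+ m n

binom₂ : ℕ → ℕ → Bool
binom₂ n       zero    = true
binom₂ zero    (suc k) = false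
binom₂ (suc n) (suc k) = binom₂ n k xor binom₂ n (suc k)

parity-C : ∀ n k → parity (n C k) ≡ binom₂ n k
parity-C n       zero    = refl
parity-C zero    (suc k) = refl
parity-C (suc n) (suc k) = begin
  parity (suc n C suc k)                ≡⟨ cong parity (nCk+nC[k+1]≡[n+1]C[k+1] n k) ⟨
  parity (n C k ℕ.+ n C suc k)          ≡⟨ parity-+ (n C k) (n C suc k) ⟩
  parity (n C k) xor parity (n C suc k) ≡⟨ cong₂ _xor_ (parity-C n k) (parity-C n (suc k)) ⟩
  binom₂ n k xor binom₂ n (suc k)       ∎

k>n⇒binom₂≡false : ∀ {n k} → n < k → binom₂ n k ≡ false
k>n⇒binom₂≡false {zero}  {suc k} _         = refl
k>n⇒binom₂≡false {suc n} {suc k} (s≤s n<k) =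
  cong₂ _xor_ (k>n⇒binom₂≡false n<k) (k>n⇒binom₂≡false (m≤n⇒m≤1+n n<k))

binom₂-sym : ∀ {n k} → k ≤ n → binom₂ n k ≡ binom₂ n (n ∸ k)
binom₂-sym {n} {k} k≤n = begin
  binom₂ n k             ≡⟨ parity-C n k ⟨
  parity (n C k)         ≡⟨ cong parity (nCk≡nC[n∸k] k≤n) ⟩
  parity (n C (n ∸ k))   ≡⟨ parity-C n (n ∸ k) ⟩
  binom₂ n (n ∸ k)       ∎

sumℕ : ℕ → (ℕ → Bool) → Bool
sumℕ N f = sum {N} (f ∘ toℕ)

sumℕ-cong : ∀ N {f g : ℕ → Bool} → (∀ k → f k ≡ g k) → sumℕ N f ≡ sumℕ N g
sumℕ-cong N f≗g = sum-cong-≗ {N} (f≗g ∘ toℕ)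

sumℕ-xor : ∀ N f g → sumℕ N (λ k → f k xor g k) ≡ sumℕ N f xor sumℕ N g
sumℕ-xor N f g = ∑-distrib-+ {N} (f ∘ toℕ) (g ∘ toℕ)

sumℕ-truncate : ∀ {M N} → M ≤ N → (f : ℕ → Bool) → (∀ k → M ≤ k → f k ≡ false) →
                sumℕ N f ≡ sumℕ M f
sumℕ-truncate {N = N} z≤n f vanish =
  trans (sumℕ-cong N (λ k → vanish k z≤n)) (sum-replicate-zero N)
sumℕ-truncate (s≤s M≤N) f vanish =
  cong (f 0 xor_) (sumℕ-truncate M≤N (f ∘ suc) (λ k → vanish (suc k) ∘ s≤s))

binomialTransform : (ℕ → Bool) → ℕ → Bool
binomialTransform h n = sumℕ (suc n) (λ k → h k ∧ binom₂ n k)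

binomialTransform-extend : ∀ {N} h j → j < N →
                           sumℕ N (λ k → h k ∧ binom₂ j k) ≡ binomialTransform h j
binomialTransform-extend h j j<N = sumℕ-truncate j<N (λ k → h k ∧ binom₂ j k)
  (λ k j<k → trans (cong (h k ∧_) (k>n⇒binom₂≡false j<k)) (∧-zeroʳ (h k)))

binomialTransform-xor : ∀ f g n →
  binomialTransform (λ k → f k xor g k) n ≡ binomialTransform f n xor binomialTransform g n
binomialTransform-xor f g n = begin
  sumℕ (suc n) (λ k → (f k xor g k) ∧ binom₂ n k)
    ≡⟨ sumℕ-cong (suc n) (λ k → ∧-distribʳ-xor (binom₂ n k) (f k) (g k)) ⟩
  sumℕ (suc n) (λ k → f k ∧ binom₂ n k xor g k ∧ binom₂ n k)
    ≡⟨ sumℕ-xor (suc n) (λ k → f k ∧ binom₂ n k) (λ k → g k ∧ binom₂ n k) ⟩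
  binomialTransform f n xor binomialTransform g n ∎

binomialTransform-suc : ∀ h n →
  binomialTransform h (suc n) ≡ binomialTransform h n xor binomialTransform (h ∘ suc) n
binomialTransform-suc h n = begin
  h 0 ∧ true xor sumℕ (suc n) (λ k → h (suc k) ∧ (binom₂ n k xor binom₂ n (suc k)))
    ≡⟨ cong (h 0 ∧ true xor_) (trans
         (sumℕ-cong (suc n) (λ k → ∧-distribˡ-xor (h (suc k)) (binom₂ n k) (binom₂ n (suc k))))
         (sumℕ-xor (suc n) (λ k → h (suc k) ∧ binom₂ n k) (λ k → h (suc k) ∧ binom₂ n (suc k)))) ⟩
  h 0 ∧ true xor (T[h∘suc] xor shifted)
    ≡⟨ cong (h 0 ∧ true xor_) (xor-comm T[h∘suc] shifted) ⟩
  h 0 ∧ true xor (shifted xor T[h∘suc])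
    ≡⟨ xor-assoc (h 0 ∧ true) shifted T[h∘suc] ⟨
  sumℕ (suc (suc n)) (λ k → h k ∧ binom₂ n k) xor T[h∘suc]
    ≡⟨ cong (_xor T[h∘suc]) (binomialTransform-extend h n (m≤n⇒m≤1+n (n<1+n n))) ⟩
  binomialTransform h n xor T[h∘suc] ∎
  where
  T[h∘suc] = binomialTransform (h ∘ suc) n
  shifted  = sumℕ (suc n) (λ k → h (suc k) ∧ binom₂ n (suc k))

binomialTransform-column : ∀ i j → binomialTransform (λ k → binom₂ k i) j ≡ (i ≡ᵇ j)
binomialTransform-column zero    zero    = refl
binomialTransform-column (suc i) zero    = refl
binomialTransform-column zero    (suc j) =
  trans (binomialTransform-suc (λ k → binom₂ k 0) j)
        (xor-same (binomialTransform (λ k → binom₂ k 0) j))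
binomialTransform-column (suc i) (suc j) = begin
  binomialTransform column₊ (suc j)
    ≡⟨ binomialTransform-suc column₊ j ⟩
  T column₊ xor binomialTransform (λ k → column k xor column₊ k) j
    ≡⟨ cong (T column₊ xor_) (binomialTransform-xor column column₊ j) ⟩
  T column₊ xor (T column xor T column₊)
    ≡⟨ cong (T column₊ xor_) (xor-comm (T column) (T column₊)) ⟩
  T column₊ xor (T column₊ xor T column)
    ≡⟨ xor-cancelˡ (T column₊) (T column) ⟩
  T column
    ≡⟨ binomialTransform-column i j ⟩
  (i ≡ᵇ j) ∎
  where
  column column₊ : ℕ → Bool
  column  k = binom₂ k i
  column₊ k = binom₂ k (suc i)
  T : (ℕ → Bool) → Bool
  T h = binomialTransform h j

binomialTransform-reversed : ∀ {n i} j → i ≤ n → j ≤ n →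
  binomialTransform (λ k → binom₂ (n ∸ k) i) j ≡ binom₂ (n ∸ j) (n ∸ i)
binomialTransform-reversed {n} {i} zero i≤n _ = begin
  binom₂ n i ∧ true xor false ≡⟨ cong (_xor false) (∧-identityʳ (binom₂ n i)) ⟩
  binom₂ n i xor false        ≡⟨ xor-identityʳ (binom₂ n i) ⟩
  binom₂ n i                  ≡⟨ binom₂-sym i≤n ⟩
  binom₂ n (n ∸ i)            ∎
binomialTransform-reversed {suc n} {i} (suc j) i≤1+n (s≤s j≤n)
  with m≤n⇒m<n∨m≡n i≤1+n
... | inj₁ (s≤s i≤n) = begin
  binomialTransform row (suc j)
    ≡⟨ binomialTransform-suc row j ⟩
  binomialTransform row j xor binomialTransform (row ∘ suc) j
    ≡⟨ cong₂ _xor_ (binomialTransform-reversed j i≤1+n (m≤n⇒m≤1+n j≤n))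
                   (binomialTransform-reversed j i≤n j≤n) ⟩
  binom₂ (suc n ∸ j) (suc n ∸ i) xor binom₂ (n ∸ j) (n ∸ i)
    ≡⟨ cong₂ (λ a b → binom₂ a b xor binom₂ (n ∸ j) (n ∸ i)) (+-∸-assoc 1 j≤n) (+-∸-assoc 1 i≤n) ⟩
  (binom₂ (n ∸ j) (n ∸ i) xor binom₂ (n ∸ j) (suc (n ∸ i))) xor binom₂ (n ∸ j) (n ∸ i)
    ≡⟨ xor-comm _ (binom₂ (n ∸ j) (n ∸ i)) ⟩
  binom₂ (n ∸ j) (n ∸ i) xor (binom₂ (n ∸ j) (n ∸ i) xor binom₂ (n ∸ j) (suc (n ∸ i)))
    ≡⟨ xor-cancelˡ (binom₂ (n ∸ j) (n ∸ i)) (binom₂ (n ∸ j) (suc (n ∸ i))) ⟩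
  binom₂ (n ∸ j) (suc (n ∸ i))
    ≡⟨ cong (binom₂ (n ∸ j)) (+-∸-assoc 1 i≤n) ⟨
  binom₂ (n ∸ j) (suc n ∸ i) ∎
  where
  row : ℕ → Bool
  row k = binom₂ (suc n ∸ k) i
... | inj₂ refl = begin
  binomialTransform row (suc j)
    ≡⟨ binomialTransform-suc row j ⟩
  binomialTransform row j xor binomialTransform (row ∘ suc) j
    ≡⟨ cong₂ _xor_ (binomialTransform-reversed j i≤1+n (m≤n⇒m≤1+n j≤n)) shifted-vanishes ⟩
  binom₂ (suc n ∸ j) (n ∸ n) xor false
    ≡⟨ cong (λ a → binom₂ (suc n ∸ j) a xor false) (n∸n≡0 n) ⟩
  true
    ≡⟨ cong (binom₂ (n ∸ j)) (n∸n≡0 n) ⟨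
  binom₂ (n ∸ j) (n ∸ n) ∎
  where
  row : ℕ → Bool
  row k = binom₂ (suc n ∸ k) (suc n)
  shifted-vanishes : binomialTransform (row ∘ suc) j ≡ false
  shifted-vanishes = sumℕ-truncate {N = suc j} z≤n (λ k → row (suc k) ∧ binom₂ j k)
    (λ k _ → cong (_∧ binom₂ j k) (k>n⇒binom₂≡false (s≤s (m∸n≤m n k))))

⌊⌋-⇔ : ∀ {a b} {A : Set a} {B : Set b} → A ⇔ B → (a? : Dec A) (b? : Dec B) → ⌊ a? ⌋ ≡ ⌊ b? ⌋
⌊⌋-⇔ A⇔B a? b? = trans (isYes≗does a?) (trans (does-⇔ A⇔B a? b?) (sym (isYes≗does b?)))

toℕ≡ᵇtoℕ : ∀ {m} (i j : Fin m) → (toℕ i ≡ᵇ toℕ j) ≡ ⌊ i ≟ j ⌋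
toℕ≡ᵇtoℕ i j = sym (trans (⌊⌋-⇔ (mk⇔ (cong toℕ) toℕ-injective) (i ≟ j) (toℕ i ℕ.≟ toℕ j))
                          (isYes≗does (toℕ i ℕ.≟ toℕ j)))

≡opposite-swap : ∀ {m} {i j : Fin m} → i ≡ opposite j → j ≡ opposite i
≡opposite-swap {j = j} i≡j′ = trans (sym (opposite-involutive j)) (cong opposite (sym i≡j′))

opposite-injective : ∀ {m} {i j : Fin m} → opposite i ≡ opposite j → i ≡ j
opposite-injective {i = i} {j} eq =
  trans (sym (opposite-involutive i)) (trans (cong opposite eq) (opposite-involutive j))

Σ₂-cong : ∀ {m} {f g : Fin m → Bool} → (∀ k → f k ≡ g k) → Σ₂ f ≡ Σ₂ g
Σ₂-cong {zero}  f≗g = refl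
Σ₂-cong {suc m} f≗g = cong₂ _xor_ (f≗g zero) (Σ₂-cong (f≗g ∘ suc))

Σ₂≡sum : ∀ {m} (f : Fin m → Bool) → Σ₂ f ≡ sum f
Σ₂≡sum {zero}  f = refl
Σ₂≡sum {suc m} f = cong (f zero xor_) (Σ₂≡sum (f ∘ suc))

Σ₂-select : ∀ {m} (g : Fin m → Bool) c → Σ₂ (λ k → g k ∧ ⌊ k ≟ c ⌋) ≡ g c
Σ₂-select {suc m} g zero = begin
  g zero ∧ true xor Σ₂ (λ k → g (suc k) ∧ false)
    ≡⟨ cong₂ _xor_ (∧-identityʳ (g zero)) (Σ₂-cong (∧-zeroʳ ∘ g ∘ suc)) ⟩
  g zero xor Σ₂ {m} (λ _ → false)
    ≡⟨ cong (g zero xor_) (trans (Σ₂≡sum {m} (λ _ → false)) (sum-replicate-zero m)) ⟩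
  g zero xor false
    ≡⟨ xor-identityʳ (g zero) ⟩
  g zero ∎
Σ₂-select {suc m} g (suc c) =
  trans (cong₂ _xor_ (∧-zeroʳ (g zero))
                     (Σ₂-cong (λ k → cong (g (suc k) ∧_) (⌊⌋-map′ (cong suc) suc-injective (k ≟ c)))))
        (Σ₂-select (g ∘ suc) c)

⊗-J : ∀ {m} (A : Mat m) i j → (A ⊗ J m) i j ≡ A i (opposite j)
⊗-J A i j = trans
  (Σ₂-cong (λ k → cong (A i k ∧_)
    (⌊⌋-⇔ (mk⇔ ≡opposite-swap ≡opposite-swap) (j ≟ opposite k) (k ≟ opposite j))))
  (Σ₂-select (A i) (opposite j))

J-⊗ : ∀ {m} (A : Mat m) i j → (J m ⊗ A) i j ≡ A (opposite i) j
J-⊗ A i j = trans (Σ₂-cong (λ k → ∧-comm ⌊ k ≟ opposite i ⌋ (A k j)))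
                  (Σ₂-select (λ k → A k j) (opposite i))

⊗-P : ∀ {m} (A : Mat m) i (h : ℕ → Bool) → (∀ k → A i k ≡ h (toℕ k)) →
      ∀ j → (A ⊗ P m) i j ≡ binomialTransform h (toℕ j)
⊗-P {m} A i h row j = begin
  Σ₂ (λ k → A i k ∧ P m k j)
    ≡⟨ Σ₂-cong {m} (λ k → cong₂ _∧_ (row k) (parity-C (toℕ j) (toℕ k))) ⟩
  Σ₂ {m} (λ k → h (toℕ k) ∧ binom₂ (toℕ j) (toℕ k))
    ≡⟨ Σ₂≡sum {m} (λ k → h (toℕ k) ∧ binom₂ (toℕ j) (toℕ k)) ⟩
  sumℕ m (λ k → h k ∧ binom₂ (toℕ j) k)
    ≡⟨ binomialTransform-extend h (toℕ j) (toℕ<n j) ⟩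
  binomialTransform h (toℕ j) ∎

P²≋I : ∀ {m} → P m ⊗ P m ≋ I m
P²≋I {m} i j = begin
  (P m ⊗ P m) i j
    ≡⟨ ⊗-P (P m) i (λ k → binom₂ k (toℕ i)) (λ k → parity-C (toℕ k) (toℕ i)) j ⟩
  binomialTransform (λ k → binom₂ k (toℕ i)) (toℕ j)
    ≡⟨ binomialTransform-column (toℕ i) (toℕ j) ⟩
  (toℕ i ≡ᵇ toℕ j)
    ≡⟨ toℕ≡ᵇtoℕ i j ⟩
  I m i j ∎

J²≋I : ∀ {m} → J m ⊗ J m ≋ I m
J²≋I {m} i j = begin
  (J m ⊗ J m) i j               ≡⟨ J-⊗ (J m) i j ⟩
  ⌊ j ≟ opposite (opposite i) ⌋ ≡⟨ cong (λ k → ⌊ j ≟ k ⌋) (opposite-involutive i) ⟩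
  ⌊ j ≟ i ⌋                     ≡⟨ ⌊⌋-⇔ (mk⇔ sym sym) (j ≟ i) (i ≟ j) ⟩
  I m i j                       ∎

PJ : ∀ m → Mat m
PJ m = P m ⊗ J m

PJP≡JPJ : ∀ {n} (i j : Fin (suc n)) →
          (PJ (suc n) ⊗ P (suc n)) i j ≡ P (suc n) (opposite i) (opposite j)
PJP≡JPJ {n} i j = begin
  (PJ (suc n) ⊗ P (suc n)) i j
    ≡⟨ ⊗-P (PJ (suc n)) i reversedColumn reversedRow j ⟩
  binomialTransform reversedColumn (toℕ j)
    ≡⟨ binomialTransform-reversed (toℕ j) (toℕ≤pred[n] i) (toℕ≤pred[n] j) ⟩
  binom₂ (n ∸ toℕ j) (n ∸ toℕ i)
    ≡⟨ cong₂ binom₂ (opposite-prop j) (opposite-prop i) ⟨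
  binom₂ (toℕ (opposite j)) (toℕ (opposite i))
    ≡⟨ parity-C (toℕ (opposite j)) (toℕ (opposite i)) ⟨
  P (suc n) (opposite i) (opposite j) ∎
  where
  reversedColumn : ℕ → Bool
  reversedColumn k = binom₂ (n ∸ k) (toℕ i)
  reversedRow : ∀ k → PJ (suc n) i k ≡ reversedColumn (toℕ k)
  reversedRow k = begin
    PJ (suc n) i k                    ≡⟨ ⊗-J (P (suc n)) i k ⟩
    P (suc n) i (opposite k)          ≡⟨ parity-C (toℕ (opposite k)) (toℕ i) ⟩
    binom₂ (toℕ (opposite k)) (toℕ i) ≡⟨ cong (λ x → binom₂ x (toℕ i)) (opposite-prop k) ⟩
    reversedColumn (toℕ k)            ∎

[PJ]²≡JP : ∀ {n} (i j : Fin (suc n)) → (PJ (suc n) ⊗ PJ (suc n)) i j ≡ P (suc n) (opposite i) j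
[PJ]²≡JP {n} i j = begin
  (PJ (suc n) ⊗ PJ (suc n)) i j
    ≡⟨ Σ₂-cong (λ k → cong (PJ (suc n) i k ∧_) (⊗-J (P (suc n)) k j)) ⟩
  (PJ (suc n) ⊗ P (suc n)) i (opposite j)
    ≡⟨ PJP≡JPJ i (opposite j) ⟩
  P (suc n) (opposite i) (opposite (opposite j))
    ≡⟨ cong (P (suc n) (opposite i)) (opposite-involutive j) ⟩
  P (suc n) (opposite i) j ∎

[PJ]³≋I : ∀ {n} → PJ (suc n) ⊗ PJ (suc n) ⊗ PJ (suc n) ≋ I (suc n)
[PJ]³≋I {n} i j = begin
  (PJ (suc n) ⊗ PJ (suc n) ⊗ PJ (suc n)) i j
    ≡⟨ Σ₂-cong (λ k → cong₂ _∧_ ([PJ]²≡JP i k) (⊗-J (P (suc n)) k j)) ⟩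
  (P (suc n) ⊗ P (suc n)) (opposite i) (opposite j)
    ≡⟨ P²≋I (opposite i) (opposite j) ⟩
  ⌊ opposite i ≟ opposite j ⌋
    ≡⟨ ⌊⌋-⇔ (mk⇔ opposite-injective (cong opposite)) (opposite i ≟ opposite j) (i ≟ j) ⟩
  I (suc n) i j ∎

lemma6 : ∀ (m : ℕ) → 1 ≤ m →
    (P m ⊗ P m ≋ I m) × (J m ⊗ J m ≋ I m) × ((P m ⊗ J m) ⊗ (P m ⊗ J m) ⊗ (P m ⊗ J m) ≋ I m)
lemma6 (suc n) _ = P²≋I , J²≋I , [PJ]³≋I
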